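{- Let $\Pi_q$ be a projective plane of order $q$ and $3\le r\le q+1$. Then $m_r(\Pi_q)\ge\binom{r+1}{2}$. Moreover, if $m_r(\Pi_q)=\binom{r+1}{2}$ and $A$ is a percolating set with $|A|=\binom{r+1}{2}$, then $A$ is contained in the union of $r$ lines in general position.
   Context: A finite projective plane $\Pi_q$ of order $q\ge 2$ has $q^2+q+1$ points and $q^2+q+1$ lines; every line contains $q+1$ points, every point lies on $q+1$ lines, any two lines meet in exactly one point and any two points lie on exactly one line. $r$-neighbor line percolation: for a set $A$ of points let $A^0=A$ and for $s\ge1$ let $A^s=A^{s-1}\cup\{P: \exists \text{ line } l\ni P \text{ with } |l\cap A^{s-1}|\ge r\}$; $A$ percolates if $A^k$ equals the whole point set for some $k$. $m_r(\Pi_q)$ is the minimum size of a percolating set. A set of lines is in general position if no three of them pass through a common point. -}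

module Defs where

open import Data.Nat using (ℕ; zero; suc; _+_; _*_; _≤_; _≤ᵇ_)
open import Data.Bool using (Bool; true; false; _∧_; _∨_; T)
open import Data.Fin using (Fin)
open import Data.Fin.Subset using (Subset; ∣_∣; _∩_; _∈_; ⊤)
open import Data.Vec using (tabulate; lookup)
open import Data.List using (List; allFin)
open import Data.Bool.ListAction using (any)
open import Data.Product using (Σ; ∃; _×_)
open import Data.Empty using (⊥)
open import Relation.Nullary using (¬_)
open import Relation.Binary.PropositionalEquality using (_≡_; _≢_)
open import Function using (_∘_)

numPts : ℕ → ℕ
numPts q = q * q + q + 1

-- A finite projective plane of order q: points and lines are both indexed by
-- Fin (q²+q+1); incidence is a Boolean relation  P I l  ("P lies on l").
record ProjectivePlane (q : ℕ) : Set where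
  field
    _I_ : Fin (numPts q) → Fin (numPts q) → Bool

  Point : Set
  Point = Fin (numPts q)

  Line : Set
  Line = Fin (numPts q)

  pts : Line → Subset (numPts q)
  pts l = tabulate (λ P → P I l)

  lns : Point → Subset (numPts q)
  lns P = tabulate (λ l → P I l)

  field
    order≥2       : 2 ≤ q
    line-size     : ∀ l → ∣ pts l ∣ ≡ suc q
    point-degree  : ∀ P → ∣ lns P ∣ ≡ suc q
    lines-meet    : ∀ l m → l ≢ m → ∣ pts l ∩ pts m ∣ ≡ 1
    points-joined : ∀ P Q → P ≢ Q → ∣ lns P ∩ lns Q ∣ ≡ 1

module _ {q : ℕ} (Π : ProjectivePlane q) where
  open ProjectivePlane Π

  percStep : ℕ → Subset (numPts q) → Subset (numPts q)
  percStep r A = tabulate λ P →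
    lookup A P ∨ any (λ l → (P I l) ∧ (r ≤ᵇ ∣ pts l ∩ A ∣)) (allFin (numPts q))

  percIter : ℕ → ℕ → Subset (numPts q) → Subset (numPts q)
  percIter r zero    A = A
  percIter r (suc k) A = percStep r (percIter r k A)

  Percolates : ℕ → Subset (numPts q) → Set
  Percolates r A = Σ ℕ λ k → percIter r k A ≡ ⊤

  MinPercolatingSize : ℕ → ℕ → Set
  MinPercolatingSize r b =
    (Σ (Subset (numPts q)) λ A → Percolates r A × ∣ A ∣ ≡ b)
    × (∀ A → Percolates r A → b ≤ ∣ A ∣)

  GeneralPosition : (n : ℕ) → (Fin n → Line) → Set
  GeneralPosition n L =
    (∀ i j → i ≢ j → L i ≢ L j)
    × (∀ (P : Point) (i j k : Fin n) → i ≢ j → j ≢ k → i ≢ k →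
         ¬ (T (P I L i) × T (P I L j) × T (P I L k)))

  CoveredBy : (n : ℕ) → (Fin n → Line) → Subset (numPts q) → Set
  CoveredBy n L A = ∀ P → P ∈ A → Σ (Fin n) λ i → T (P I L i)

module Submission where

-- Choose lines m₁, m₂, … greedily, each new line distinct from the earlier ones and containing
-- at least r points of Aᵢ = A ∪ m₁ ∪ … ∪ mᵢ. While i < r such a line exists: otherwise Aᵢ is
-- closed under the percolation rule and contains A, hence every point, and then any further line
-- qualifies. The line m_{i+1} meets m₁ ∪ … ∪ mᵢ in at most i points, so at least r − i of its
-- points in Aᵢ are new points of A; hence |A| ≥ r + (r − 1) + … + 1. If equality holds every
-- estimate is tight: A lies on m₁, …, m_r, and each m_{i+1} meets the earlier lines in i distinct
-- points, which is general position.

open import Data.Bool using (Bool; true; false; T; _∧_; _∨_)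
open import Data.Bool.Properties using (T-∧; T-∨; T-≡)
open import Data.Fin using (Fin; zero; suc)
import Data.Fin.Properties as Fin
open import Data.Fin.Subset using (Subset; ∣_∣; _∩_; _∈_; _⊆_)
open import Data.Fin.Subset.Properties using (∈⊤; p⊆q⇒∣p∣≤∣q∣; x∈p∩q⁺; x∈p∩q⁻)
open import Data.List using (allFin)
open import Data.List.Relation.Unary.Any using (satisfied)
open import Data.List.Relation.Unary.Any.Properties using (any⁻)
open import Data.Nat using (ℕ; zero; suc; _+_; _*_; _≤_; _<_; z≤n; s≤s; _≤?_)
open import Data.Nat.Combinatorics using (_C_; nCk+nC[k+1]≡[n+1]C[k+1]; nC1≡n)
open import Data.Nat.Properties
open import Algebra.Properties.CommutativeMonoid.Sum +-0-commutativeMonoid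
  using (sum-syntax; sum-cong-≗; sum-replicate-zero; ∑-distrib-+)
open import Data.Nat.Tactic.RingSolver using (solve-∀)
open import Data.Product using (Σ; ∃; _×_; _,_; proj₁; proj₂)
open import Data.Sum using (inj₁; inj₂)
open import Data.Vec using (Vec; []; _∷_; lookup; tabulate)
open import Data.Vec.Properties using (lookup-zipWith; lookup∘tabulate; []=⇒lookup; lookup⇒[]=)
open import Function using (_∘_)
open import Function.Bundles using (Equivalence)
open import Function.Definitions using (Injective)
open import Relation.Nullary using (¬_; Dec; yes; no; contradiction)
open import Relation.Nullary.Decidable using (¬?; _×-dec_; decidable-stable)
open import Relation.Binary.PropositionalEquality
  using (_≡_; _≢_; refl; sym; trans; cong; cong₂; subst; module ≡-Reasoning)

open import Defs

open Equivalence using (to; from)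

⟦_⟧ : Bool → ℕ
⟦ true ⟧  = 1
⟦ false ⟧ = 0

⟦⟧≤1 : ∀ b → ⟦ b ⟧ ≤ 1
⟦⟧≤1 true  = ≤-refl
⟦⟧≤1 false = z≤n

T⇒⟦⟧≡1 : ∀ {b} → T b → ⟦ b ⟧ ≡ 1
T⇒⟦⟧≡1 {true} _ = refl

⟦⟧≥1⇒T : ∀ {b} → 1 ≤ ⟦ b ⟧ → T b
⟦⟧≥1⇒T {true} _ = _

⟦x∧y⟧≤⟦x⟧ : ∀ x y → ⟦ x ∧ y ⟧ ≤ ⟦ x ⟧
⟦x∧y⟧≤⟦x⟧ true  y = ⟦⟧≤1 y
⟦x∧y⟧≤⟦x⟧ false y = z≤n

⟦x∧[y∨z]⟧≤⟦x∧y⟧+⟦x∧z⟧ : ∀ x y z → ⟦ x ∧ (y ∨ z) ⟧ ≤ ⟦ x ∧ y ⟧ + ⟦ x ∧ z ⟧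
⟦x∧[y∨z]⟧≤⟦x∧y⟧+⟦x∧z⟧ false y     z = z≤n
⟦x∧[y∨z]⟧≤⟦x∧y⟧+⟦x∧z⟧ true  true  z = m≤m+n 1 ⟦ z ⟧
⟦x∧[y∨z]⟧≤⟦x∧y⟧+⟦x∧z⟧ true  false z = ≤-refl

⟦x∧[y∨z]⟧+⟦y∧z⟧≡⟦x∧z⟧+⟦y∧[x∨z]⟧ : ∀ x y z →
  ⟦ x ∧ (y ∨ z) ⟧ + ⟦ y ∧ z ⟧ ≡ ⟦ x ∧ z ⟧ + ⟦ y ∧ (x ∨ z) ⟧
⟦x∧[y∨z]⟧+⟦y∧z⟧≡⟦x∧z⟧+⟦y∧[x∨z]⟧ false y     z     = refl
⟦x∧[y∨z]⟧+⟦y∧z⟧≡⟦x∧z⟧+⟦y∧[x∨z]⟧ true  true  true  = refl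
⟦x∧[y∨z]⟧+⟦y∧z⟧≡⟦x∧z⟧+⟦y∧[x∨z]⟧ true  true  false = refl
⟦x∧[y∨z]⟧+⟦y∧z⟧≡⟦x∧z⟧+⟦y∧[x∨z]⟧ true  false true  = refl
⟦x∧[y∨z]⟧+⟦y∧z⟧≡⟦x∧z⟧+⟦y∧[x∨z]⟧ true  false false = refl

+-≤-tight : ∀ {a b c d} → a ≤ c → b ≤ d → c + d ≤ a + b → c ≤ a × d ≤ b
+-≤-tight {a} {b} {c} {d} a≤c b≤d c+d≤a+b =
  +-cancelʳ-≤ d c a (≤-trans c+d≤a+b (+-monoʳ-≤ a b≤d)) ,
  +-cancelˡ-≤ c d b (≤-trans c+d≤a+b (+-monoˡ-≤ b a≤c))

[1+n]C2≡n+nC2 : ∀ n → suc n C 2 ≡ n + n C 2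
[1+n]C2≡n+nC2 n = trans (sym (nCk+nC[k+1]≡[n+1]C[k+1] n 1)) (cong (_+ n C 2) (nC1≡n n))

n*n≡nC2+[1+n]C2 : ∀ n → n * n ≡ n C 2 + suc n C 2
n*n≡nC2+[1+n]C2 zero    = refl
n*n≡nC2+[1+n]C2 (suc n) = begin
  suc n * suc n
    ≡⟨ square-suc n ⟩
  n * n + (n + suc n)
    ≡⟨ cong (_+ (n + suc n)) (n*n≡nC2+[1+n]C2 n) ⟩
  (n C 2 + suc n C 2) + (n + suc n)
    ≡⟨ cong (λ c → (n C 2 + c) + (n + suc n)) ([1+n]C2≡n+nC2 n) ⟩
  (n C 2 + (n + n C 2)) + (n + suc n)
    ≡⟨ regroup n (n C 2) ⟩
  (n + n C 2) + (suc n + (n + n C 2))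
    ≡⟨ cong₂ (λ c c′ → c + (suc n + c′)) ([1+n]C2≡n+nC2 n) ([1+n]C2≡n+nC2 n) ⟨
  suc n C 2 + (suc n + suc n C 2)
    ≡⟨ cong (suc n C 2 +_) ([1+n]C2≡n+nC2 (suc n)) ⟨
  suc n C 2 + suc (suc n) C 2
    ∎
  where
  open ≡-Reasoning
  square-suc : ∀ n → suc n * suc n ≡ n * n + (n + suc n)
  square-suc = solve-∀
  regroup : ∀ n c → (c + (n + c)) + (n + suc n) ≡ (n + c) + (suc n + (n + c))
  regroup = solve-∀

∑-mono-≤ : ∀ {n} {f g : Fin n → ℕ} → (∀ i → f i ≤ g i) → ∑[ i < n ] f i ≤ ∑[ i < n ] g i
∑-mono-≤ {zero}  _   = z≤n
∑-mono-≤ {suc n} f≤g = +-mono-≤ (f≤g zero) (∑-mono-≤ (f≤g ∘ suc))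

∑-mono-< : ∀ {n} {f g : Fin n → ℕ} → (∀ i → f i ≤ g i) → ∀ j → f j < g j →
           ∑[ i < n ] f i < ∑[ i < n ] g i
∑-mono-< f≤g zero    fj<gj = +-mono-<-≤ fj<gj (∑-mono-≤ (f≤g ∘ suc))
∑-mono-< f≤g (suc j) fj<gj = +-mono-≤-< (f≤g zero) (∑-mono-< (f≤g ∘ suc) j fj<gj)

∑-tight : ∀ {n} {f g : Fin n → ℕ} → (∀ i → f i ≤ g i) →
          ∑[ i < n ] g i ≤ ∑[ i < n ] f i → ∀ i → g i ≤ f i
∑-tight f≤g ∑g≤∑f i = ≮⇒≥ λ fi<gi → <⇒≱ (∑-mono-< f≤g i fi<gi) ∑g≤∑f

∑-term : ∀ {n} (f : Fin n → ℕ) i → f i ≤ ∑[ j < n ] f j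
∑-term f zero    = m≤m+n (f zero) _
∑-term f (suc i) = ≤-trans (∑-term (f ∘ suc) i) (m≤n+m _ (f zero))

∑-pair : ∀ {n} (f : Fin n → ℕ) {i j} → i ≢ j → f i + f j ≤ ∑[ k < n ] f k
∑-pair f {zero}  {zero}  i≢j = contradiction refl i≢j
∑-pair f {zero}  {suc j} _   = +-monoʳ-≤ (f zero) (∑-term (f ∘ suc) j)
∑-pair f {suc i} {zero}  _   =
  ≤-trans (≤-reflexive (+-comm (f (suc i)) (f zero))) (+-monoʳ-≤ (f zero) (∑-term (f ∘ suc) i))
∑-pair f {suc i} {suc j} i≢j = ≤-trans (∑-pair (f ∘ suc) (i≢j ∘ cong suc)) (m≤n+m _ (f zero))

∣p∣≡∑ : ∀ {n} (p : Subset n) → ∣ p ∣ ≡ ∑[ x < n ] ⟦ lookup p x ⟧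
∣p∣≡∑ []          = refl
∣p∣≡∑ (true ∷ p)  = cong suc (∣p∣≡∑ p)
∣p∣≡∑ (false ∷ p) = ∣p∣≡∑ p

∣tabulate∩tabulate∣≡∑ : ∀ {n} (f g : Fin n → Bool) →
                        ∣ tabulate f ∩ tabulate g ∣ ≡ ∑[ x < n ] ⟦ f x ∧ g x ⟧
∣tabulate∩tabulate∣≡∑ f g = trans (∣p∣≡∑ (tabulate f ∩ tabulate g)) (sum-cong-≗ λ x →
  cong ⟦_⟧ (trans (lookup-zipWith _∧_ x (tabulate f) (tabulate g))
                  (cong₂ _∧_ (lookup∘tabulate f x) (lookup∘tabulate g x))))

module _ {n : ℕ} where

  ∈⇒T-lookup : ∀ {p : Subset n} {x} → x ∈ p → T (lookup p x)
  ∈⇒T-lookup x∈p = from T-≡ ([]=⇒lookup x∈p)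

  T-lookup⇒∈ : ∀ {p : Subset n} {x} → T (lookup p x) → x ∈ p
  T-lookup⇒∈ {p} {x} t = lookup⇒[]= x p (to T-≡ t)

  ∈-tabulate⁻ : ∀ {f : Fin n → Bool} {x} → x ∈ tabulate f → T (f x)
  ∈-tabulate⁻ {f} {x} x∈ = subst T (lookup∘tabulate f x) (∈⇒T-lookup x∈)

  ∈-tabulate⁺ : ∀ {f : Fin n → Bool} {x} → T (f x) → x ∈ tabulate f
  ∈-tabulate⁺ {f} {x} t = T-lookup⇒∈ (subst T (sym (lookup∘tabulate f x)) t)

  Fresh : ∀ {i} → Fin n → Vec (Fin n) i → Set
  Fresh y xs = ∀ j → lookup xs j ≢ y

  fresh? : ∀ {i} y (xs : Vec (Fin n) i) → Dec (Fresh y xs)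
  fresh? y xs = Fin.all? λ j → ¬? (lookup xs j Fin.≟ y)

  ∃-fresh : ∀ {i} → i < n → (xs : Vec (Fin n) i) → ∃ λ y → Fresh y xs
  ∃-fresh {i} i<n xs with Fin.any? (λ y → fresh? y xs)
  ... | yes fresh = fresh
  ... | no ¬fresh = contradiction (Fin.injective⇒≤ position-injective) (<⇒≱ i<n)
    where
    occurrence : ∀ y → ∃ λ j → lookup xs j ≡ y
    occurrence y with Fin.¬∀⟶∃¬ i _ (λ j → ¬? (lookup xs j Fin.≟ y)) (¬fresh ∘ (y ,_))
    ... | j , ¬≢ = j , decidable-stable (lookup xs j Fin.≟ y) ¬≢
    position-injective : Injective _≡_ _≡_ (proj₁ ∘ occurrence)
    position-injective {y} {y′} same =
      trans (sym (proj₂ (occurrence y))) (trans (cong (lookup xs) same) (proj₂ (occurrence y′)))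

-- Closed sets and lines meeting a family of lines

module _ {q : ℕ} (Π : ProjectivePlane q) where
  open ProjectivePlane Π

  Closed : ℕ → Subset (numPts q) → Set
  Closed r B = ∀ l → r ≤ ∣ pts l ∩ B ∣ → pts l ⊆ B

  ∣pts∩∣-mono : ∀ {X Y} l → X ⊆ Y → ∣ pts l ∩ X ∣ ≤ ∣ pts l ∩ Y ∣
  ∣pts∩∣-mono {X} {Y} l X⊆Y = p⊆q⇒∣p∣≤∣q∣ {p = pts l ∩ X} {q = pts l ∩ Y} λ P∈l∩X →
    let P∈l , P∈X = x∈p∩q⁻ (pts l) X P∈l∩X in x∈p∩q⁺ (P∈l , X⊆Y P∈X)

  percStep-⊆ : ∀ {r B X} → Closed r B → X ⊆ B → percStep Π r X ⊆ B
  percStep-⊆ {r} closed X⊆B P∈ with to T-∨ (∈-tabulate⁻ P∈)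
  ... | inj₁ P∈X   = X⊆B (T-lookup⇒∈ P∈X)
  ... | inj₂ onRichLine with satisfied (any⁻ _ (allFin (numPts q)) onRichLine)
  ... | l , P∈l∧rich with to T-∧ P∈l∧rich
  ... | P∈l , rich = closed l (≤-trans (≤ᵇ⇒≤ r _ rich) (∣pts∩∣-mono l X⊆B)) (∈-tabulate⁺ P∈l)

  percIter-⊆ : ∀ {r B X} → Closed r B → X ⊆ B → ∀ k → percIter Π r k X ⊆ B
  percIter-⊆ closed X⊆B zero    = X⊆B
  percIter-⊆ closed X⊆B (suc k) = percStep-⊆ closed (percIter-⊆ closed X⊆B k)

  percolates⇒closed-superset-full : ∀ {r A B} → Closed r B → A ⊆ B → Percolates Π r A → ∀ P → P ∈ B
  percolates⇒closed-superset-full closed A⊆B (k , Aᵏ≡⊤) P =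
    percIter-⊆ closed A⊆B k (subst (P ∈_) (sym Aᵏ≡⊤) ∈⊤)

  covered : ∀ {i} → Vec Line i → Point → Bool
  covered []       P = false
  covered (l ∷ ls) P = P I l ∨ covered ls P

  covered⁺ : ∀ {i} (ls : Vec Line i) j {P} → T (P I lookup ls j) → T (covered ls P)
  covered⁺ (l ∷ ls) zero    P∈l = from T-∨ (inj₁ P∈l)
  covered⁺ (l ∷ ls) (suc j) P∈l = from T-∨ (inj₂ (covered⁺ ls j P∈l))

  covered⁻ : ∀ {i} (ls : Vec Line i) {P} → T (covered ls P) → ∃ λ j → T (P I lookup ls j)
  covered⁻ (l ∷ ls) P∈ls with to T-∨ P∈ls
  ... | inj₁ P∈l   = zero , P∈l
  ... | inj₂ P∈ls′ = let j , P∈lⱼ = covered⁻ ls P∈ls′ in suc j , P∈lⱼ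

  ⟦∧covered⟧≤∑ : ∀ {i} x (ls : Vec Line i) P →
                 ⟦ x ∧ covered ls P ⟧ ≤ ∑[ j < i ] ⟦ x ∧ P I lookup ls j ⟧
  ⟦∧covered⟧≤∑ true  []       P = z≤n
  ⟦∧covered⟧≤∑ false []       P = z≤n
  ⟦∧covered⟧≤∑ x     (l ∷ ls) P = ≤-trans (⟦x∧[y∨z]⟧≤⟦x∧y⟧+⟦x∧z⟧ x (P I l) (covered ls P))
                                           (+-monoʳ-≤ _ (⟦∧covered⟧≤∑ x ls P))

  incidences-with-fresh : ∀ {i} m (ls : Vec Line i) → Fresh m ls →
    ∑[ P < numPts q ] ∑[ j < i ] ⟦ P I m ∧ P I lookup ls j ⟧ ≡ i
  incidences-with-fresh m []       _     = sum-replicate-zero (numPts q)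
  incidences-with-fresh m (l ∷ ls) fresh = begin
    ∑[ P < numPts q ] (⟦ P I m ∧ P I l ⟧ + ∑[ j < _ ] ⟦ P I m ∧ P I lookup ls j ⟧)
      ≡⟨ ∑-distrib-+ (λ P → ⟦ P I m ∧ P I l ⟧) (λ P → ∑[ j < _ ] ⟦ P I m ∧ P I lookup ls j ⟧) ⟩
    ∑[ P < numPts q ] ⟦ P I m ∧ P I l ⟧ + ∑[ P < numPts q ] ∑[ j < _ ] ⟦ P I m ∧ P I lookup ls j ⟧
      ≡⟨ cong₂ _+_ meet-once (incidences-with-fresh m ls (fresh ∘ suc)) ⟩
    suc _ ∎
    where
    open ≡-Reasoning
    meet-once : ∑[ P < numPts q ] ⟦ P I m ∧ P I l ⟧ ≡ 1
    meet-once = trans (sym (∣tabulate∩tabulate∣≡∑ (_I m) (_I l))) (lines-meet m l (fresh zero ∘ sym))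

  covered-on : ∀ {i} → Line → Vec Line i → ℕ
  covered-on m ls = ∑[ P < numPts q ] ⟦ P I m ∧ covered ls P ⟧

  covered-on≤length : ∀ {i} m (ls : Vec Line i) → Fresh m ls → covered-on m ls ≤ i
  covered-on≤length m ls fresh =
    ≤-trans (∑-mono-≤ λ P → ⟦∧covered⟧≤∑ (P I m) ls P) (≤-reflexive (incidences-with-fresh m ls fresh))

  concurrent⇒covered-on<length : ∀ {i} m (ls : Vec Line i) → Fresh m ls → ∀ {P j k} → j ≢ k →
    T (P I m) → T (P I lookup ls j) → T (P I lookup ls k) → covered-on m ls < i
  concurrent⇒covered-on<length m ls fresh {P} {j} {k} j≢k P∈m P∈lⱼ P∈lₖ =
    ≤-trans (∑-mono-< (λ Q → ⟦∧covered⟧≤∑ (Q I m) ls Q) P covered-twice)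
            (≤-reflexive (incidences-with-fresh m ls fresh))
    where
    covered-twice : ⟦ P I m ∧ covered ls P ⟧ < ∑[ j < _ ] ⟦ P I m ∧ P I lookup ls j ⟧
    covered-twice = begin-strict
      ⟦ P I m ∧ covered ls P ⟧
        <⟨ s≤s (⟦⟧≤1 _) ⟩
      2
        ≡⟨ cong₂ _+_ (T⇒⟦⟧≡1 (from T-∧ (P∈m , P∈lⱼ))) (T⇒⟦⟧≡1 (from T-∧ (P∈m , P∈lₖ))) ⟨
      ⟦ P I m ∧ P I lookup ls j ⟧ + ⟦ P I m ∧ P I lookup ls k ⟧
        ≤⟨ ∑-pair (λ j → ⟦ P I m ∧ P I lookup ls j ⟧) j≢k ⟩
      ∑[ j < _ ] ⟦ P I m ∧ P I lookup ls j ⟧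
        ∎
      where open ≤-Reasoning

  GeneralPosition-∷ : ∀ {i} {m} {ls : Vec Line i} → Fresh m ls →
    (∀ P j k → j ≢ k → ¬ (T (P I m) × T (P I lookup ls j) × T (P I lookup ls k))) →
    GeneralPosition Π i (lookup ls) → GeneralPosition Π (suc i) (lookup (m ∷ ls))
  GeneralPosition-∷ {m = m} {ls} fresh no-concurrence (distinct , no-triple) = distinct′ , no-triple′
    where
    distinct′ : ∀ a b → a ≢ b → lookup (m ∷ ls) a ≢ lookup (m ∷ ls) b
    distinct′ zero    zero    a≢b = contradiction refl a≢b
    distinct′ zero    (suc b) _   = fresh b ∘ sym
    distinct′ (suc a) zero    _   = fresh a
    distinct′ (suc a) (suc b) a≢b = distinct a b (a≢b ∘ cong suc)
    no-triple′ : ∀ P a b c → a ≢ b → b ≢ c → a ≢ c →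
      ¬ (T (P I lookup (m ∷ ls) a) × T (P I lookup (m ∷ ls) b) × T (P I lookup (m ∷ ls) c))
    no-triple′ P zero    zero    _       a≢b _   _   _ = a≢b refl
    no-triple′ P zero    (suc _) zero    _   _   a≢c _ = a≢c refl
    no-triple′ P (suc _) zero    zero    _   b≢c _   _ = b≢c refl
    no-triple′ P zero    (suc b) (suc c) _   b≢c _   = no-concurrence P b c (b≢c ∘ cong suc)
    no-triple′ P (suc a) zero    (suc c) _   _   a≢c (x , y , z) =
      no-concurrence P a c (a≢c ∘ cong suc) (y , x , z)
    no-triple′ P (suc a) (suc b) zero    a≢b _   _   (x , y , z) =
      no-concurrence P a b (a≢b ∘ cong suc) (z , x , y)
    no-triple′ P (suc a) (suc b) (suc c) a≢b b≢c a≢c =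
      no-triple P a b c (a≢b ∘ cong suc) (b≢c ∘ cong suc) (a≢c ∘ cong suc)

  -- The greedy sequence of lines

  module _ (r : ℕ) (A : Subset (numPts q)) where

    grown : ∀ {i} → Vec Line i → Subset (numPts q)
    grown ls = tabulate λ P → lookup A P ∨ covered ls P

    Extends : ∀ {i} → Line → Vec Line i → Set
    Extends m ls = Fresh m ls × r ≤ ∣ pts m ∩ grown ls ∣

    -- The most recently chosen line is the head of the vector.
    data Greedy : ∀ {i} → Vec Line i → Set where
      []   : Greedy []
      step : ∀ {i m} {ls : Vec Line i} → Extends m ls → Greedy ls → Greedy (m ∷ ls)

    grown-closed : ∀ {i} {ls : Vec Line i} → ¬ (∃ λ m → Extends m ls) → Closed r (grown ls)
    grown-closed {ls = ls} ¬ext l rich with Fin.any? (λ j → lookup ls j Fin.≟ l)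
    ... | yes (j , refl) = λ P∈l → ∈-tabulate⁺ (from T-∨ (inj₂ (covered⁺ ls j (∈-tabulate⁻ P∈l))))
    ... | no  l∉ls       = contradiction (l , (λ j lⱼ≡l → l∉ls (j , lⱼ≡l)) , rich) ¬ext

    extension-exists : r ≤ suc q → Percolates Π r A →
                       ∀ {i} → i < r → (ls : Vec Line i) → ∃ λ m → Extends m ls
    extension-exists r≤q+1 perc i<r ls
      with Fin.any? (λ m → fresh? m ls ×-dec (r ≤? ∣ pts m ∩ grown ls ∣))
    ... | yes ext = ext
    ... | no ¬ext = let m , fresh = ∃-fresh (≤-trans i<r (≤-trans r≤q+1 q+1≤N)) ls
                    in  contradiction (m , fresh , every-line-rich m) ¬ext
      where
      q+1≤N : suc q ≤ numPts q
      q+1≤N = subst (_≤ numPts q) (+-comm q 1) (+-monoˡ-≤ 1 (m≤n+m q (q * q)))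
      all-grown : ∀ P → P ∈ grown ls
      all-grown = percolates⇒closed-superset-full (grown-closed {ls = ls} ¬ext)
        (λ P∈A → ∈-tabulate⁺ (from T-∨ (inj₁ (∈⇒T-lookup P∈A)))) perc
      every-line-rich : ∀ m → r ≤ ∣ pts m ∩ grown ls ∣
      every-line-rich m = begin
        r                    ≤⟨ r≤q+1 ⟩
        suc q                ≡⟨ line-size m ⟨
        ∣ pts m ∣            ≤⟨ p⊆q⇒∣p∣≤∣q∣ {p = pts m} {q = pts m ∩ grown ls}
                                  (λ P∈m → x∈p∩q⁺ (P∈m , all-grown _)) ⟩
        ∣ pts m ∩ grown ls ∣ ∎
        where open ≤-Reasoning

    greedy-exists : r ≤ suc q → Percolates Π r A → Σ (Vec Line r) Greedy
    greedy-exists r≤q+1 perc = build r ≤-refl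
      where
      build : ∀ i → i ≤ r → Σ (Vec Line i) Greedy
      build zero    _   = [] , []
      build (suc i) i<r =
        let ls , greedy = build i (<⇒≤ i<r)
            m , ext     = extension-exists r≤q+1 perc i<r ls
        in  m ∷ ls , step ext greedy

    covered-in-A : ∀ {i} → Vec Line i → ℕ
    covered-in-A ls = ∑[ P < numPts q ] ⟦ lookup A P ∧ covered ls P ⟧

    overlaps : ∀ {i} → Vec Line i → ℕ
    overlaps []       = 0
    overlaps (m ∷ ls) = covered-on m ls + overlaps ls

    -- A point of m in grown ls is on a line of ls or is a point of A that m newly covers.
    covered-in-A-∷ : ∀ {i} m (ls : Vec Line i) →
      covered-in-A (m ∷ ls) + covered-on m ls ≡ covered-in-A ls + ∣ pts m ∩ grown ls ∣
    covered-in-A-∷ m ls = begin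
      covered-in-A (m ∷ ls) + covered-on m ls
        ≡⟨ ∑-distrib-+ (λ P → ⟦ a P ∧ (P I m ∨ covered ls P) ⟧) (λ P → ⟦ P I m ∧ covered ls P ⟧) ⟨
      ∑[ P < numPts q ] (⟦ a P ∧ (P I m ∨ covered ls P) ⟧ + ⟦ P I m ∧ covered ls P ⟧)
        ≡⟨ sum-cong-≗ (λ P → ⟦x∧[y∨z]⟧+⟦y∧z⟧≡⟦x∧z⟧+⟦y∧[x∨z]⟧ (a P) (P I m) (covered ls P)) ⟩
      ∑[ P < numPts q ] (⟦ a P ∧ covered ls P ⟧ + ⟦ P I m ∧ (a P ∨ covered ls P) ⟧)
        ≡⟨ ∑-distrib-+ (λ P → ⟦ a P ∧ covered ls P ⟧) (λ P → ⟦ P I m ∧ (a P ∨ covered ls P) ⟧) ⟩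
      covered-in-A ls + ∑[ P < numPts q ] ⟦ P I m ∧ (a P ∨ covered ls P) ⟧
        ≡⟨ cong (covered-in-A ls +_) (∣tabulate∩tabulate∣≡∑ (_I m) _) ⟨
      covered-in-A ls + ∣ pts m ∩ grown ls ∣ ∎
      where
      open ≡-Reasoning
      a : Point → Bool
      a = lookup A

    greedy-lower : ∀ {i} {ls : Vec Line i} → Greedy ls → i * r ≤ covered-in-A ls + overlaps ls
    greedy-lower []                               = z≤n
    greedy-lower {suc i} {m ∷ ls} (step (_ , rich) greedy) = begin
      r + i * r
        ≤⟨ +-mono-≤ rich (greedy-lower greedy) ⟩
      ∣ pts m ∩ grown ls ∣ + (covered-in-A ls + overlaps ls)
        ≡⟨ +-assoc _ (covered-in-A ls) (overlaps ls) ⟨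
      (∣ pts m ∩ grown ls ∣ + covered-in-A ls) + overlaps ls
        ≡⟨ cong (_+ overlaps ls) (+-comm _ (covered-in-A ls)) ⟩
      (covered-in-A ls + ∣ pts m ∩ grown ls ∣) + overlaps ls
        ≡⟨ cong (_+ overlaps ls) (covered-in-A-∷ m ls) ⟨
      (covered-in-A (m ∷ ls) + covered-on m ls) + overlaps ls
        ≡⟨ +-assoc _ (covered-on m ls) (overlaps ls) ⟩
      covered-in-A (m ∷ ls) + overlaps (m ∷ ls)
        ∎
      where open ≤-Reasoning

    overlaps≤C2 : ∀ {i} {ls : Vec Line i} → Greedy ls → overlaps ls ≤ i C 2
    overlaps≤C2 []                                = z≤n
    overlaps≤C2 {suc i} {m ∷ ls} (step (fresh , _) greedy) =
      ≤-trans (+-mono-≤ (covered-on≤length m ls fresh) (overlaps≤C2 greedy))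
              (≤-reflexive (sym ([1+n]C2≡n+nC2 i)))

    overlaps≥C2⇒GeneralPosition : ∀ {i} {ls : Vec Line i} → Greedy ls → i C 2 ≤ overlaps ls →
                                 GeneralPosition Π i (lookup ls)
    overlaps≥C2⇒GeneralPosition [] _ = (λ ()) , λ _ ()
    overlaps≥C2⇒GeneralPosition {suc i} {m ∷ ls} (step (fresh , _) greedy) tight =
      let i≤covered-on , C2≤overlaps = +-≤-tight (covered-on≤length m ls fresh) (overlaps≤C2 greedy)
                                          (≤-trans (≤-reflexive (sym ([1+n]C2≡n+nC2 i))) tight)
      in  GeneralPosition-∷ {ls = ls} fresh
            (λ P j k j≢k (P∈m , P∈lⱼ , P∈lₖ) →
              <⇒≱ (concurrent⇒covered-on<length m ls fresh j≢k P∈m P∈lⱼ P∈lₖ) i≤covered-on)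
            (overlaps≥C2⇒GeneralPosition greedy C2≤overlaps)

    covered-in-A≤∣A∣ : ∀ {i} (ls : Vec Line i) → covered-in-A ls ≤ ∣ A ∣
    covered-in-A≤∣A∣ ls =
      ≤-trans (∑-mono-≤ λ P → ⟦x∧y⟧≤⟦x⟧ (lookup A P) (covered ls P)) (≤-reflexive (sym (∣p∣≡∑ A)))

    ∣A∣≤covered-in-A⇒CoveredBy : ∀ {i} (ls : Vec Line i) → ∣ A ∣ ≤ covered-in-A ls →
                                 CoveredBy Π i (lookup ls) A
    ∣A∣≤covered-in-A⇒CoveredBy ls ∣A∣≤ P P∈A = covered⁻ ls (proj₂ (to T-∧ (⟦⟧≥1⇒T (begin
      1                               ≡⟨ T⇒⟦⟧≡1 (∈⇒T-lookup P∈A) ⟨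
      ⟦ lookup A P ⟧                  ≤⟨ ∑-tight (λ Q → ⟦x∧y⟧≤⟦x⟧ (lookup A Q) (covered ls Q))
                                                 (≤-trans (≤-reflexive (sym (∣p∣≡∑ A))) ∣A∣≤) P ⟩
      ⟦ lookup A P ∧ covered ls P ⟧   ∎))))
      where open ≤-Reasoning

    greedy-count : ∀ {ls : Vec Line r} → Greedy ls →
                   r C 2 + suc r C 2 ≤ covered-in-A ls + overlaps ls
    greedy-count greedy = ≤-trans (≤-reflexive (sym (n*n≡nC2+[1+n]C2 r))) (greedy-lower greedy)

    greedy-lower-bound : ∀ {ls : Vec Line r} → Greedy ls → suc r C 2 ≤ ∣ A ∣
    greedy-lower-bound {ls} greedy = begin
      suc r C 2      ≤⟨ +-cancelˡ-≤ (r C 2) _ _ (begin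
        r C 2 + suc r C 2             ≤⟨ greedy-count greedy ⟩
        covered-in-A ls + overlaps ls ≤⟨ +-monoʳ-≤ (covered-in-A ls) (overlaps≤C2 greedy) ⟩
        covered-in-A ls + r C 2       ≡⟨ +-comm (covered-in-A ls) (r C 2) ⟩
        r C 2 + covered-in-A ls       ∎) ⟩
      covered-in-A ls ≤⟨ covered-in-A≤∣A∣ ls ⟩
      ∣ A ∣           ∎
      where open ≤-Reasoning

    greedy-extremal : ∀ {ls : Vec Line r} → Greedy ls → ∣ A ∣ ≡ suc r C 2 →
                      GeneralPosition Π r (lookup ls) × CoveredBy Π r (lookup ls) A
    greedy-extremal {ls} greedy ∣A∣≡ =
      let ∣A∣≤ , C2≤overlaps = +-≤-tight (covered-in-A≤∣A∣ ls) (overlaps≤C2 greedy) ∣A∣+rC2≤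
      in  overlaps≥C2⇒GeneralPosition greedy C2≤overlaps , ∣A∣≤covered-in-A⇒CoveredBy ls ∣A∣≤
      where
      ∣A∣+rC2≤ : ∣ A ∣ + r C 2 ≤ covered-in-A ls + overlaps ls
      ∣A∣+rC2≤ = ≤-trans (≤-reflexive (trans (cong (_+ r C 2) ∣A∣≡) (+-comm (suc r C 2) (r C 2))))
                         (greedy-count greedy)

proposition6 : (q : ℕ) (Π : ProjectivePlane q) (r : ℕ) → 3 ≤ r → r ≤ suc q →
    ((A : Subset (numPts q)) → Percolates Π r A → (suc r C 2) ≤ ∣ A ∣)
    × (MinPercolatingSize Π r (suc r C 2) →
       (A : Subset (numPts q)) → Percolates Π r A → ∣ A ∣ ≡ suc r C 2 →
       Σ (Fin r → Fin (numPts q)) λ L →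
         GeneralPosition Π r L × CoveredBy Π r L A)
proposition6 q Π r _ r≤q+1 =
    (λ A perc → greedy-lower-bound Π r A (proj₂ (greedy-exists Π r A r≤q+1 perc)))
  , λ _ A perc ∣A∣≡ → let ls , greedy = greedy-exists Π r A r≤q+1 perc
                      in  lookup ls , greedy-extremal Π r A greedy ∣A∣≡
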